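{- Let $(\mathcal{Y},\eta)$ be an $(n,m)$-voltage operator and let $\tau\in\mathrm{Aut}(\mathcal{Y})$ satisfy $\eta(W\tau)=\eta(W)$ for all $W\in\Pi(\mathcal{Y})$. Then for every $n$-premaniplex $\mathcal{X}$, the map $\tilde\tau$ defined by $(x,y)\tilde\tau=(x,y\tau)$ is an automorphism of $\mathcal{X}\rtimes_\eta\mathcal{Y}$ (and thus a lift of $\tau$).
   Context: A graph may have multiple edges and semi-edges. An $n$-premaniplex is such a graph with edges coloured by $\{0,\dots,n-1\}$ so that every vertex (flag) is the starting point of exactly one dart of each colour, and whenever $|i-j|\ge2$ every alternating path of length 4 with colours $i,j$ is closed; $x^i$ is the end of the $i$-dart at $x$. $\mathcal{C}^n=\langle r_0,\dots,r_{n-1}\mid r_i^2=1,\ (r_ir_j)^2=1\ (|i-j|\ge2)\rangle$ acts on the left on flags by $r_ix=x^i$. Automorphisms are bijections of flags preserving all $i$-adjacencies, acting on the right; an automorphism $\tau$ of $\mathcal{Y}$ maps each path $W$ to a path $W\tau$. For a flag $y$ of an $m$-premaniplex $\mathcal{Y}$ and $\omega\in\mathcal{C}^m$, $P_\omega(y)$ is the homotopy class of paths from $y$ whose successive colours $i_1,\dots,i_k$ satisfy $r_{i_k}\cdots r_{i_1}=\omega$ (homotopic iff same start and same element of $\mathcal{C}^m$); these form the fundamental groupoid $\Pi(\mathcal{Y})$. A voltage assignment $\eta:\Pi(\mathcal{Y})\to\mathcal{C}^n$ satisfies $\eta(W_1W_2)=\eta(W_2)\eta(W_1)$; $(\mathcal{Y},\eta)$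 is an $(n,m)$-voltage operator. $\mathcal{X}\rtimes_\eta\mathcal{Y}$ is the $m$-premaniplex with flags $\mathcal{X}\times\mathcal{Y}$ and $(x,y)^i=(\eta(P_{r_i}(y))x,y^i)$. An automorphism $\tilde\tau$ of $\mathcal{X}\rtimes_\eta\mathcal{Y}$ is a lift of $\tau\in\mathrm{Aut}(\mathcal{Y})$ if for every flag $(x,y)$ the second coordinate of $(x,y)\tilde\tau$ is $y\tau$. Standing assumption: $\mathcal{Y}$ has a spanning tree (forest if disconnected) all of whose darts have trivial voltage. -}

module Defs where

open import Data.Nat using (ℕ; _≤_; _+_)
open import Data.Fin using (Fin; toℕ)
open import Data.List using (List; []; _∷_; _++_; [_])
open import Data.Product using (_×_; _,_; proj₁; proj₂)
open import Data.Sum using (_⊎_)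
open import Function using (Bijective)
open import Relation.Binary.PropositionalEquality using (_≡_)

Far : ∀ {n} → Fin n → Fin n → Set
Far i j = (2 + toℕ i ≤ toℕ j) ⊎ (2 + toℕ j ≤ toℕ i)

-- The Coxeter group C^n, presented as words in the generators modulo
-- the congruence generated by the defining relations.
-- The word  a₁ ∷ a₂ ∷ … ∷ aₖ ∷ []  denotes  r_{a₁} r_{a₂} ⋯ r_{aₖ};
-- multiplication is concatenation, the identity is [].

Word : ℕ → Set
Word n = List (Fin n)

infix 4 _≈w_
data _≈w_ {n : ℕ} : Word n → Word n → Set where
  ≈refl  : ∀ {u} → u ≈w u
  ≈sym   : ∀ {u v} → u ≈w v → v ≈w u
  ≈trans : ∀ {u v w} → u ≈w v → v ≈w w → u ≈w w
  ≈cong  : ∀ {u u' v v'} → u ≈w u' → v ≈w v' → (u ++ v) ≈w (u' ++ v')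
  ≈inv   : ∀ i → (i ∷ i ∷ []) ≈w []
  ≈comm  : ∀ i j → Far i j → (i ∷ j ∷ i ∷ j ∷ []) ≈w []

-- Coloured graphs in which each vertex (flag) starts exactly one dart of
-- each colour: given by the map x ↦ x^i for each colour i.
-- (Semi-edges = fixed points, multiple edges allowed.)

record ColouredGraph (n : ℕ) : Set₁ where
  field
    Flag : Set
    adj  : Fin n → Flag → Flag

record Premaniplex (n : ℕ) : Set₁ where
  field
    graph : ColouredGraph n
  open ColouredGraph graph public
  field
    adj-invol : ∀ i x → adj i (adj i x) ≡ x
    adj-comm  : ∀ i j → Far i j → ∀ x → adj i (adj j (adj i (adj j x))) ≡ x

open Premaniplex public using (graph)

act : ∀ {n} (G : ColouredGraph n) → Word n → ColouredGraph.Flag G → ColouredGraph.Flag G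
act G []      x = x
act G (a ∷ w) x = ColouredGraph.adj G a (act G w x)

-- Automorphisms (acting on the right, written here as functions):
-- bijections of the flags preserving all i-adjacencies.
IsAutomorphism : ∀ {n} (G : ColouredGraph n) →
                 (ColouredGraph.Flag G → ColouredGraph.Flag G) → Set
IsAutomorphism G τ =
  Bijective _≡_ _≡_ τ × (∀ i x → τ (ColouredGraph.adj G i x) ≡ ColouredGraph.adj G i (τ x))

-- An element of Π(Y) is a homotopy class P_ω(y),
-- represented by its start flag y and a word for ω ∈ C^m; it ends at ω y.
-- P_ω(y) followed by P_ψ(ω y) is P_{ψω}(y).
-- A voltage assignment η : Π(Y) → C^n is a function on representatives,
-- well defined on homotopy classes, with η(W₁W₂) = η(W₂) η(W₁).

record VoltageAssignment {m : ℕ} (n : ℕ) (Y : Premaniplex m) : Set where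
  field
    η       : Premaniplex.Flag Y → Word m → Word n    -- η (P_ω(y)) = η y ω
    η-resp  : ∀ y {ω ω'} → ω ≈w ω' → η y ω ≈w η y ω'
    η-comp  : ∀ y ω ψ →
              η y (ψ ++ ω) ≈w (η (act (graph Y) ω y) ψ ++ η y ω)

record VoltageOperator (n m : ℕ) : Set₁ where
  field
    Y       : Premaniplex m
    voltage : VoltageAssignment n Y
  open VoltageAssignment voltage public

⋊-graph : ∀ {n m} → Premaniplex n → VoltageOperator n m → ColouredGraph m
⋊-graph {n} {m} X O = record
  { Flag = Premaniplex.Flag X × Premaniplex.Flag Y
  ; adj  = λ i p → ( act (graph X) (η (proj₂ p) [ i ]) (proj₁ p)
                   , Premaniplex.adj Y i (proj₂ p) )
  }
  where open VoltageOperator O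

-- The action of an automorphism τ of Y on Π(Y):  P_ω(y) τ = P_ω(y τ).
-- "η(Wτ) = η(W) for all W ∈ Π(Y)":
VoltagePreserving : ∀ {n m} (O : VoltageOperator n m) →
  (Premaniplex.Flag (VoltageOperator.Y O) → Premaniplex.Flag (VoltageOperator.Y O)) → Set
VoltagePreserving O τ = ∀ y ω → η (τ y) ω ≈w η y ω
  where open VoltageOperator O

{-# OPTIONS --safe #-}
module Submission where

-- Since η(P_{r_i}(y τ)) = η(P_{r_i}(y)), the flag (x, y)^i is sent by τ̃ to
-- (η(P_{r_i}(y)) x, y^i τ) = (η(P_{r_i}(y τ)) x, (y τ)^i) = ((x, y τ))^i; the
-- only subtlety is that voltages are words in C^n, so X's action must be shown
-- to respect the defining relations. Bijectivity is inherited from τ.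

open import Defs
open import Data.Product using (_,_; proj₁; proj₂; map₂)
open import Data.Product.Properties using (,-injectiveˡ; ,-injectiveʳ)
open import Data.List using ([]; _∷_; _++_; [_])
open import Function.Definitions using (Bijective; StrictlySurjective)
open import Function.Consequences.Propositional using (strictlySurjective⇒surjective)
open import Relation.Binary.PropositionalEquality using (_≡_; refl; sym; trans; cong; cong₂; module ≡-Reasoning)

act-++ : ∀ {n} (G : ColouredGraph n) u v x → act G (u ++ v) x ≡ act G u (act G v x)
act-++ G []      v x = refl
act-++ G (a ∷ u) v x = cong (ColouredGraph.adj G a) (act-++ G u v x)

act-resp-≈w : ∀ {n} (X : Premaniplex n) {u v} → u ≈w v →
              ∀ x → act (graph X) u x ≡ act (graph X) v x
act-resp-≈w X ≈refl          x = refl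
act-resp-≈w X (≈sym p)       x = sym (act-resp-≈w X p x)
act-resp-≈w X (≈trans p q)   x = trans (act-resp-≈w X p x) (act-resp-≈w X q x)
act-resp-≈w X (≈cong {u} {u'} {v} {v'} p q) x = begin
  act G (u ++ v) x      ≡⟨ act-++ G u v x ⟩
  act G u (act G v x)   ≡⟨ act-resp-≈w X p (act G v x) ⟩
  act G u' (act G v x)  ≡⟨ cong (act G u') (act-resp-≈w X q x) ⟩
  act G u' (act G v' x) ≡⟨ act-++ G u' v' x ⟨
  act G (u' ++ v') x    ∎
  where open ≡-Reasoning
        G = graph X
act-resp-≈w X (≈inv i)       x = Premaniplex.adj-invol X i x
act-resp-≈w X (≈comm i j f)  x = Premaniplex.adj-comm X i j f x

map₂-bijective : ∀ {A B : Set} {f : B → B} →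
                 Bijective _≡_ _≡_ f → Bijective _≡_ _≡_ (map₂ {A = A} f)
map₂-bijective {f = f} (f-inj , f-surj) = map₂-inj , strictlySurjective⇒surjective map₂-surj
  where
  map₂-inj : ∀ {p q} → map₂ f p ≡ map₂ f q → p ≡ q
  map₂-inj e = cong₂ _,_ (,-injectiveˡ e) (f-inj (,-injectiveʳ e))
  map₂-surj : StrictlySurjective _≡_ (map₂ f)
  map₂-surj (a , b) = (a , proj₁ (f-surj b)) , cong (a ,_) (proj₂ (f-surj b) refl)

map₂-commutes-⋊-adj : ∀ {n m} (O : VoltageOperator n m) (X : Premaniplex n)
  (τ : Premaniplex.Flag (VoltageOperator.Y O) → Premaniplex.Flag (VoltageOperator.Y O)) →
  (∀ i y → τ (Premaniplex.adj (VoltageOperator.Y O) i y) ≡ Premaniplex.adj (VoltageOperator.Y O) i (τ y)) →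
  VoltagePreserving O τ →
  ∀ i p → map₂ τ (ColouredGraph.adj (⋊-graph X O) i p) ≡ ColouredGraph.adj (⋊-graph X O) i (map₂ τ p)
map₂-commutes-⋊-adj O X τ τ-hom τ-volt i (x , y) =
  cong₂ _,_ (act-resp-≈w X (≈sym (τ-volt y [ i ])) x) (τ-hom i y)

theorem6p1 : ∀ {n m} (O : VoltageOperator n m)
             (τ : Premaniplex.Flag (VoltageOperator.Y O) → Premaniplex.Flag (VoltageOperator.Y O)) →
             IsAutomorphism (graph (VoltageOperator.Y O)) τ →
             VoltagePreserving O τ →
             (X : Premaniplex n) →
             IsAutomorphism (⋊-graph X O) (λ p → (proj₁ p , τ (proj₂ p)))
theorem6p1 O τ (τ-bij , τ-hom) τ-volt X =
  map₂-bijective τ-bij , map₂-commutes-⋊-adj O X τ τ-hom τ-volt
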